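{- Let $d\ge 2$ and $n\ge 1$ be integers and let $p'\in[0,n+1]$. Then the De Bruijn digraph $B(d,n)$ is isomorphic to the digraph $H(d^{p'},d^{n+1-p'},d)$ if and only if $\gcd(p',n+1)=1$.
   Context: For integers $a\le b$, $[a,b]=\{c\in\mathbb{Z}: a\le c\le b\}$. Digraphs may have loops and multiple arcs; an isomorphism of digraphs is a bijection of vertices preserving arc multiplicities. For positive integers $p,q$, every $a\in[0,pq-1]$ is written uniquely as $a=iq+j$ with $i\in[0,p-1]$, $j\in[0,q-1]$, denoted $a=(i,j)_{p,q}$. For positive integers $p,q$ and a divisor $d>1$ of $pq$, the digraph $H(p,q,d)$ has vertex set $[0,pq/d-1]$, where vertex $k$ represents the block $[kd,kd+d-1]$; for each $i\in[0,p-1]$, $j\in[0,q-1]$ there is one arc from the vertex whose block contains $(i,j)_{p,q}=iq+j$ to the vertex whose block contains $(q-1-j,p-1-i)_{q,p}=(q-1-j)p+(p-1-i)$ (arcs counted with multiplicity). The line digraph $L(G)$ of a digraph $G$ has the arcs of $G$ as vertices, with an arc from $(u,v)$ to $(v,w)$ whenever these are arcs of $G$. $K_d^+$ is the complete digraph on $d$ vertices with a loop at every vertex (one arc from each vertex to each vertex, including itself), and the De Bruijn digraph is $B(d,n)=L^n(K_d^+)$, the $n$-th iterated line digraph; equivalently its vertices are the words $x_1\cdots x_n$ over a $d$-letter alphabet with arcs $x_1x_2\cdots x_n\to x_2\cdots x_n y$ for every letter $y$. -}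

module Defs where

open import Data.Nat using (ℕ; zero; suc; _+_; _*_; _∸_; _^_; _/_; NonZero)
open import Data.Nat.Properties using (_≟_)
open import Data.Fin using (Fin; toℕ)
open import Data.Vec using (Vec; _∷_; []; tail; init)
open import Data.Product using (Σ; _,_)
open import Data.List using (List; map; allFin)
open import Data.Nat.ListAction using (sum)
open import Data.Bool using (Bool; true; _∧_; if_then_else_)
open import Relation.Nullary.Decidable using (⌊_⌋)
open import Relation.Binary.PropositionalEquality using (_≡_)
open import Function.Bundles using (_↔_; Inverse)

-- A digraph possibly with loops and multiple arcs: a vertex type together
-- with the number of arcs from u to v (arc multiplicity).
record Digraph : Set₁ where
  field
    Vertex : Set
    arcs   : Vertex → Vertex → ℕ
open Digraph public

_≅_ : Digraph → Digraph → Set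
G ≅ H = Σ (Vertex G ↔ Vertex H) λ σ →
          ∀ u v → arcs H (Inverse.to σ u) (Inverse.to σ v) ≡ arcs G u v

wordEq : ∀ {d m} → Vec (Fin d) m → Vec (Fin d) m → Bool
wordEq [] [] = true
wordEq (x ∷ xs) (y ∷ ys) = ⌊ toℕ x ≟ toℕ y ⌋ ∧ wordEq xs ys

B : (d n : ℕ) → Digraph
-- For n = 0, B(d,0) = L^0(K_d^+) = K_d^+ (not used by the theorem, n ≥ 1).
B d zero    = record { Vertex = Fin d ; arcs = λ _ _ → 1 }
B d (suc n) = record
  { Vertex = Vec (Fin d) (suc n)
  ; arcs   = λ x x' → if wordEq (tail x) (init x') then 1 else 0
  }

countPairs : (p q : ℕ) → (ℕ → ℕ → Bool) → ℕ
countPairs p q P =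
  sum (map (λ i → sum (map (λ j → if P (toℕ i) (toℕ j) then 1 else 0)
                           (allFin q)))
           (allFin p))

-- H(p,q,d): vertex set [0, pq/d - 1]; vertex k is the block [kd, kd+d-1];
-- for each (i,j) one arc from the block containing iq+j to the block
-- containing (q-1-j)p+(p-1-i).
H : (p q d : ℕ) → .{{_ : NonZero d}} → Digraph
H p q d = record
  { Vertex = Fin (p * q / d)
  ; arcs   = λ k l → countPairs p q λ i j →
      ⌊ (i * q + j) / d ≟ toℕ k ⌋ ∧
      ⌊ ((q ∸ 1 ∸ j) * p + (p ∸ 1 ∸ i)) / d ≟ toℕ l ⌋
  }

-- Write a vertex k of H = H(d^P, d^Q, d), where P + Q = N = n + 1, as an n-digit number in
-- base d, and call digit s of k·d + x its place s. The arc of H labelled x < d goes from k to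
-- ⌊antitranspose (k·d + x) / d⌋, and antitranspose complements the digits of its argument
-- rotated by Q places: digit t of the head is the complement of place (t + 1 + Q) mod N,
-- while the label x occupies place 0.
--
-- If g = gcd(P, N) > 1, then g also divides Q, so along arcs the places not divisible by g are
-- only permuted and complemented among themselves; the label never reaches them. After a walk
-- of even length, digit 0 of the end is therefore a digit of the start. In B(d,n) there is a
-- walk of length 2n between any two words, so an isomorphism would give one in H from 0 to 1,
-- forcing 1 = 0.
--
-- If gcd(P, N) = 1, store the letter shifted into a word j ∈ [1, n] steps ago, complemented
-- j times, at place j·P mod N. Since j·P + Q ≡ (j − 1)·P (mod N), shifting a letter into the
-- word is exactly an arc of H, and as P is invertible modulo N the encoding is a bijection.

module Submission where

open import Defs
open import Data.Bool using (Bool; true; false; _∧_; if_then_else_)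
open import Data.Empty using (⊥-elim)
open import Data.Fin as Fin using (Fin; toℕ; fromℕ<; inject₁; fromℕ)
open import Data.Fin.Properties using (toℕ<n; toℕ-fromℕ<; toℕ-injective; toℕ-inject₁)
open import Data.List as List using (List; []; _∷_; _++_; drop; foldl; map; allFin)
open import Data.List.Properties using (++-identityʳ; ++-assoc; drop-drop; map-tabulate)
open import Data.Nat
open import Data.Nat.Coprimality using (Coprime; coprime-Bézout; gcd≡1⇒coprime)
open import Data.Nat.DivMod
open import Data.Nat.Divisibility
open import Data.Nat.GCD using (gcd; gcd[m,n]∣m; gcd[m,n]∣n; module Bézout)
open import Data.Nat.GeneralisedArithmetic using (iterate)
open import Data.Nat.ListAction using (sum)
open import Data.Nat.Properties
open import Data.Nat.Solver using (module +-*-Solver)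
open import Data.Product using (∃-syntax; _×_; _,_; proj₂)
open import Data.Vec as Vec using (Vec; tail; init; last; _∷ʳ_; toList; reverse; tabulate; lookup)
open import Data.Vec.Properties using (init-∷ʳ; toList-∷ʳ; toList-injective; cast-is-id; length-toList; ∷ʳ-injectiveʳ;
  reverse-∷; reverse-reverse; reverse-involutive; init-reverse; ≡-dec; tabulate-cong; tabulate∘lookup; lookup∘tabulate)
open import Function using (_∘_; Inverse; mk↔ₛ′; _⇔_; mk⇔)
open import Relation.Binary.PropositionalEquality
open import Relation.Nullary using (Dec; yes; no; ¬_)
open import Relation.Nullary.Decidable using (⌊_⌋; isYes≗does; dec-true; dec-false)

open +-*-Solver using (solve; _:+_; _:*_; _:=_; con)

sumBelow : ℕ → (ℕ → ℕ) → ℕ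
sumBelow zero    f = 0
sumBelow (suc m) f = f 0 + sumBelow m (f ∘ suc)

syntax sumBelow m (λ a → e) = ∑[ a < m ] e

sumBelow-cong : ∀ m {f g} → (∀ a → a < m → f a ≡ g a) → sumBelow m f ≡ sumBelow m g
sumBelow-cong zero    f≡g = refl
sumBelow-cong (suc m) f≡g = cong₂ _+_ (f≡g 0 z<s) (sumBelow-cong m (λ a a<m → f≡g (suc a) (s<s a<m)))

sumBelow-zero : ∀ m {f} → (∀ a → a < m → f a ≡ 0) → sumBelow m f ≡ 0
sumBelow-zero zero    f≡0 = refl
sumBelow-zero (suc m) f≡0 = cong₂ _+_ (f≡0 0 z<s) (sumBelow-zero m (λ a a<m → f≡0 (suc a) (s<s a<m)))

sumBelow-+ : ∀ m k f → sumBelow (m + k) f ≡ sumBelow m f + ∑[ a < k ] f (m + a)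
sumBelow-+ zero    k f = refl
sumBelow-+ (suc m) k f = trans (cong (f 0 +_) (sumBelow-+ m k (f ∘ suc))) (sym (+-assoc (f 0) _ _))

sumBelow-* : ∀ p q f → ∑[ i < p ] ∑[ j < q ] f (i * q + j) ≡ sumBelow (p * q) f
sumBelow-* zero    q f = refl
sumBelow-* (suc p) q f = begin
  sumBelow q f + ∑[ i < p ] ∑[ j < q ] f (suc i * q + j)
    ≡⟨ cong (sumBelow q f +_) (sumBelow-cong p λ i _ → sumBelow-cong q λ j _ → cong f (+-assoc q (i * q) j)) ⟩
  sumBelow q f + ∑[ i < p ] ∑[ j < q ] f (q + (i * q + j))
    ≡⟨ cong (sumBelow q f +_) (sumBelow-* p q (λ a → f (q + a))) ⟩
  sumBelow q f + ∑[ a < p * q ] f (q + a)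
    ≡⟨ sym (sumBelow-+ q (p * q) f) ⟩
  sumBelow (q + p * q) f ∎
  where open ≡-Reasoning

sumBelow-single : ∀ m {k} f → k < m → (∀ a → a < m → a ≢ k → f a ≡ 0) → sumBelow m f ≡ f k
sumBelow-single (suc m) {zero}  f _ others =
  trans (cong (f 0 +_) (sumBelow-zero m λ a a<m → others (suc a) (s<s a<m) λ ())) (+-identityʳ (f 0))
sumBelow-single (suc m) {suc k} f k<m others =
  cong₂ _+_ (others 0 z<s λ ()) (sumBelow-single m (f ∘ suc) (s<s⁻¹ k<m)
    λ a a<m a≢k → others (suc a) (s<s a<m) (a≢k ∘ suc-injective))

sumBelow≢0 : ∀ m f → sumBelow m f ≢ 0 → ∃[ a ] a < m × f a ≢ 0
sumBelow≢0 zero    f ∑≢0 = ⊥-elim (∑≢0 refl)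
sumBelow≢0 (suc m) f ∑≢0 with f 0 ≟ 0
... | no f0≢0 = 0 , z<s , f0≢0
... | yes f0≡0 with sumBelow≢0 m (f ∘ suc) (λ ∑≡0 → ∑≢0 (cong₂ _+_ f0≡0 ∑≡0))
...   | a , a<m , fa≢0 = suc a , s<s a<m , fa≢0

sum-map-allFin : ∀ m f → sum (map (f ∘ toℕ) (allFin m)) ≡ sumBelow m f
sum-map-allFin m f = trans (cong sum (map-tabulate {n = m} (λ i → i) (f ∘ toℕ))) (sum-tabulate m f)
  where
  sum-tabulate : ∀ m f → sum (List.tabulate {n = m} (f ∘ toℕ)) ≡ sumBelow m f
  sum-tabulate zero    f = refl
  sum-tabulate (suc m) f = cong (f 0 +_) (sum-tabulate m (f ∘ suc))

𝟙 : Bool → ℕ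
𝟙 b = if b then 1 else 0

countPairs≡sumBelow : ∀ p q P → countPairs p q P ≡ ∑[ i < p ] ∑[ j < q ] 𝟙 (P i j)
countPairs≡sumBelow p q P =
  trans (sum-map-allFin p (λ i → sum (map ((λ j → 𝟙 (P i j)) ∘ toℕ) (allFin q))))
        (sumBelow-cong p λ i _ → sum-map-allFin q (λ j → 𝟙 (P i j)))

⌊⌋≡true : ∀ {A : Set} (a? : Dec A) → A → ⌊ a? ⌋ ≡ true
⌊⌋≡true a? a = trans (isYes≗does a?) (dec-true a? a)

⌊⌋≡false : ∀ {A : Set} (a? : Dec A) → ¬ A → ⌊ a? ⌋ ≡ false
⌊⌋≡false a? ¬a = trans (isYes≗does a?) (dec-false a? ¬a)

𝟙≢0⇒ : ∀ {A : Set} (a? : Dec A) → 𝟙 ⌊ a? ⌋ ≢ 0 → A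
𝟙≢0⇒ (yes a) _   = a
𝟙≢0⇒ (no _)  𝟙≢0 = ⊥-elim (𝟙≢0 refl)

data Walk (G : Digraph) : ℕ → Vertex G → Vertex G → Set where
  []  : ∀ {u} → Walk G 0 u u
  _∷_ : ∀ {m u v w} → arcs G u v ≢ 0 → Walk G m v w → Walk G (suc m) u w

_++ʷ_ : ∀ {G m k u v w} → Walk G m u v → Walk G k v w → Walk G (m + k) u w
[]          ++ʷ ω = ω
(arc ∷ ω′) ++ʷ ω = arc ∷ (ω′ ++ʷ ω)

≅-Walk : ∀ {G G′} ((σ , hom) : G ≅ G′) {m u v} → Walk G m u v → Walk G′ m (Inverse.to σ u) (Inverse.to σ v)
≅-Walk _         []                      = []
≅-Walk (σ , hom) (_∷_ {u = u} {v} arc ω) = (λ eq → arc (trans (sym (hom u v)) eq)) ∷ ≅-Walk (σ , hom) ω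

[m*n+o]%n≡o : ∀ m {n o} .{{_ : NonZero n}} → o < n → (m * n + o) % n ≡ o
[m*n+o]%n≡o m {n} {o} o<n = trans (cong (_% n) (+-comm (m * n) o)) (trans ([m+kn]%n≡m%n o m n) (m<n⇒m%n≡m o<n))

[m*n+o]/n≡m : ∀ m {n o} .{{_ : NonZero n}} → o < n → (m * n + o) / n ≡ m
[m*n+o]/n≡m m {n} {o} o<n = begin
  (m * n + o) / n    ≡⟨ +-distrib-/-∣ˡ o (divides-refl m) ⟩
  m * n / n + o / n  ≡⟨ cong₂ _+_ (m*n/n≡m m n) (m<n⇒m/n≡0 o<n) ⟩
  m + 0              ≡⟨ +-identityʳ m ⟩
  m                  ∎
  where open ≡-Reasoning

*+-< : ∀ {k K x X} → x < X → k < K → k * X + x < K * X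
*+-< {k} {K} {x} {X} x<X k<K = begin-strict
  k * X + x  <⟨ +-monoʳ-< (k * X) x<X ⟩
  k * X + X  ≡⟨ +-comm (k * X) X ⟩
  suc k * X  ≤⟨ *-monoˡ-≤ X k<K ⟩
  K * X      ∎
  where open ≤-Reasoning

∸1∸-< : ∀ {n} m → 0 < n → n ∸ 1 ∸ m < n
∸1∸-< {suc n} m _ = s≤s (m∸n≤m n m)

m<n⇒n≡1+[n∸1∸m]+m : ∀ {m n} → m < n → n ≡ suc ((n ∸ 1 ∸ m) + m)
m<n⇒n≡1+[n∸1∸m]+m {m} {suc n} (s≤s m≤n) = cong suc (sym (m∸n+n≡m m≤n))

*+-complement : ∀ {x X y Y} → x < X → y < Y → Y * X ∸ 1 ∸ (y * X + x) ≡ (Y ∸ 1 ∸ y) * X + (X ∸ 1 ∸ x)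
*+-complement {x} {X} {y} {Y} x<X y<Y = begin
  Y * X ∸ 1 ∸ (y * X + x)            ≡⟨ ∸-+-assoc (Y * X) 1 (y * X + x) ⟩
  Y * X ∸ (1 + (y * X + x))           ≡⟨ cong (_∸ (1 + (y * X + x))) sum≡ ⟨
  u * X + v + (1 + (y * X + x)) ∸ (1 + (y * X + x)) ≡⟨ m+n∸n≡m (u * X + v) (1 + (y * X + x)) ⟩
  u * X + v                           ∎
  where
  open ≡-Reasoning
  u = Y ∸ 1 ∸ y
  v = X ∸ 1 ∸ x
  sum≡ : u * X + v + (1 + (y * X + x)) ≡ Y * X
  sum≡ = begin
    u * X + v + (1 + (y * X + x))   ≡⟨ cong (λ X → u * X + v + (1 + (y * X + x))) (m<n⇒n≡1+[n∸1∸m]+m x<X) ⟩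
    u * suc (v + x) + v + (1 + (y * suc (v + x) + x))
      ≡⟨ solve 4 (λ u v x y → u :* (con 1 :+ (v :+ x)) :+ v :+ (con 1 :+ (y :* (con 1 :+ (v :+ x)) :+ x))
                         := (con 1 :+ (u :+ y)) :* (con 1 :+ (v :+ x))) refl u v x y ⟩
    suc (u + y) * suc (v + x)        ≡⟨ cong₂ _*_ (m<n⇒n≡1+[n∸1∸m]+m y<Y) (m<n⇒n≡1+[n∸1∸m]+m x<X) ⟨
    Y * X                            ∎

[m%n*o]%n≡[m*o]%n : ∀ m o n .{{_ : NonZero n}} → m % n * o % n ≡ m * o % n
[m%n*o]%n≡[m*o]%n m o n = begin
  m % n * o % n            ≡⟨ %-distribˡ-* (m % n) o n ⟩
  m % n % n * (o % n) % n  ≡⟨ cong (λ r → r * (o % n) % n) (m%n%n≡m%n m n) ⟩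
  m % n * (o % n) % n      ≡⟨ %-distribˡ-* m o n ⟨
  m * o % n                ∎
  where open ≡-Reasoning

[m%n+o]%n≡[m+o]%n : ∀ m o n .{{_ : NonZero n}} → (m % n + o) % n ≡ (m + o) % n
[m%n+o]%n≡[m+o]%n m o n = begin
  (m % n + o) % n            ≡⟨ %-distribˡ-+ (m % n) o n ⟩
  (m % n % n + o % n) % n    ≡⟨ cong (λ r → (r + o % n) % n) (m%n%n≡m%n m n) ⟩
  (m % n + o % n) % n        ≡⟨ %-distribˡ-+ m o n ⟨
  (m + o) % n                ∎
  where open ≡-Reasoning

-- When x * m ≡ -1 (mod n), the inverse is x * (n - 1).
inverse-mod : ∀ {m k} → Coprime m (2 + k) → ∃[ e ] e * m % (2 + k) ≡ 1
inverse-mod {m} {k} coprime with coprime-Bézout coprime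
... | Bézout.+- x y 1+yn≡xm = x , trans (cong (_% (2 + k)) (sym 1+yn≡xm)) ([m+kn]%n≡m%n 1 y (2 + k))
... | Bézout.-+ x zero    ()
... | Bézout.-+ x (suc y) 1+xm≡[1+y]n = x * suc k , trans (cong (_% (2 + k)) e*m≡) ([m+kn]%n≡m%n 1 (k + y * suc k) (2 + k))
  where
  e*m≡ : x * suc k * m ≡ 1 + (k + y * suc k) * (2 + k)
  e*m≡ = +-cancelˡ-≡ (suc k) _ _ (begin
    suc k + x * suc k * m      ≡⟨ solve 3 (λ k x m → (con 1 :+ k) :+ x :* (con 1 :+ k) :* m
                                                 := (con 1 :+ k) :* (con 1 :+ x :* m)) refl k x m ⟩
    suc k * (1 + x * m)        ≡⟨ cong (suc k *_) 1+xm≡[1+y]n ⟩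
    suc k * (suc y * (2 + k))  ≡⟨ solve 2 (λ k y → (con 1 :+ k) :* ((con 1 :+ y) :* (con 2 :+ k))
                                                 := (con 1 :+ k) :+ (con 1 :+ (k :+ y :* (con 1 :+ k)) :* (con 2 :+ k))) refl k y ⟩
    suc k + (1 + (k + y * suc k) * (2 + k)) ∎)
    where open ≡-Reasoning

iterate-comm : ∀ {A : Set} (f : A → A) x m → iterate f (f x) m ≡ f (iterate f x m)
iterate-comm f x zero    = refl
iterate-comm f x (suc m) = iterate-comm f (f x) m

iterate-+ : ∀ {A : Set} (f : A → A) x m k → iterate f x (m + k) ≡ iterate f (iterate f x m) k
iterate-+ f x zero    k = refl
iterate-+ f x (suc m) k = iterate-+ f (f x) m k

module Digits (d : ℕ) .{{_ : NonZero d}} where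

  digit : ℕ → ℕ → ℕ
  digit a zero    = a % d
  digit a (suc t) = digit (a / d) t

  digit-< : ∀ a t → digit a t < d
  digit-< a zero    = m%n<n a d
  digit-< a (suc t) = digit-< (a / d) t

  digit[0] : ∀ t → digit 0 t ≡ 0
  digit[0] zero    = m<n⇒m%n≡m (>-nonZero⁻¹ d)
  digit[0] (suc t) = trans (cong (λ b → digit b t) (0/n≡0 d)) (digit[0] t)

  digit₀-*+ : ∀ k {x} → x < d → digit (k * d + x) 0 ≡ x
  digit₀-*+ k x<d = [m*n+o]%n≡o k x<d

  digitₛ-*+ : ∀ k {x} t → x < d → digit (k * d + x) (suc t) ≡ digit k t
  digitₛ-*+ k t x<d = cong (λ b → digit b t) ([m*n+o]/n≡m k x<d)

  /d-< : ∀ m {a} → a < d ^ suc m → a / d < d ^ m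
  /d-< m {a} a<d^sm = m<n*o⇒m/o<n (subst (a <_) (*-comm d (d ^ m)) a<d^sm)

  *d^suc+≡ : ∀ m x y → x * d ^ suc m + y ≡ (x * d ^ m + y / d) * d + y % d
  *d^suc+≡ m x y = begin
    x * (d * d ^ m) + y                    ≡⟨ cong (x * (d * d ^ m) +_) (m≡m%n+[m/n]*n y d) ⟩
    x * (d * d ^ m) + (y % d + y / d * d)  ≡⟨ solve 5 (λ x d D r s → x :* (d :* D) :+ (r :+ s :* d)
                                                         := (x :* D :+ s) :* d :+ r) refl x d (d ^ m) (y % d) (y / d) ⟩
    (x * d ^ m + y / d) * d + y % d        ∎
    where open ≡-Reasoning

  digit-low : ∀ m {x y t} → t < m → y < d ^ m → digit (x * d ^ m + y) t ≡ digit y t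
  digit-low (suc m) {x} {y} {zero}  _   y<d^m =
    trans (cong (λ b → digit b 0) (*d^suc+≡ m x y)) (digit₀-*+ (x * d ^ m + y / d) (m%n<n y d))
  digit-low (suc m) {x} {y} {suc t} t<m y<d^m =
    trans (cong (λ b → digit b (suc t)) (*d^suc+≡ m x y))
          (trans (digitₛ-*+ (x * d ^ m + y / d) t (m%n<n y d)) (digit-low m {x} (s<s⁻¹ t<m) (/d-< m y<d^m)))

  digit-high : ∀ m {x y} t → y < d ^ m → digit (x * d ^ m + y) (m + t) ≡ digit x t
  digit-high zero    {x} {zero} t _ = cong (λ b → digit b t) (trans (+-identityʳ (x * 1)) (*-identityʳ x))
  digit-high zero    {y = suc _} t (s<s ())
  digit-high (suc m) {x} {y}    t y<d^m =
    trans (cong (λ b → digit b (suc m + t)) (*d^suc+≡ m x y))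
          (trans (digitₛ-*+ (x * d ^ m + y / d) (m + t) (m%n<n y d)) (digit-high m {x} t (/d-< m y<d^m)))

  digit-injective : ∀ m {a b} → a < d ^ m → b < d ^ m → (∀ t → t < m → digit a t ≡ digit b t) → a ≡ b
  digit-injective zero    {zero}  {zero}  _        _        _    = refl
  digit-injective zero    {suc _}         (s<s ()) _        _
  digit-injective zero    {zero}  {suc _} _        (s<s ()) _
  digit-injective (suc m) {a}     {b}     a<d^m    b<d^m    same = begin
    a                  ≡⟨ m≡m%n+[m/n]*n a d ⟩
    a % d + a / d * d  ≡⟨ cong₂ (λ r s → r + s * d) (same 0 z<s) high ⟩
    b % d + b / d * d  ≡⟨ m≡m%n+[m/n]*n b d ⟨
    b                  ∎
    where
    open ≡-Reasoning
    high : a / d ≡ b / d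
    high = digit-injective m (/d-< m a<d^m) (/d-< m b<d^m) λ t t<m → same (suc t) (s<s t<m)

  fromDigits : ℕ → (ℕ → ℕ) → ℕ
  fromDigits zero    δ = 0
  fromDigits (suc m) δ = fromDigits m (δ ∘ suc) * d + δ 0

  fromDigits-< : ∀ m δ → (∀ t → t < m → δ t < d) → fromDigits m δ < d ^ m
  fromDigits-< zero    δ δ<d = z<s
  fromDigits-< (suc m) δ δ<d = subst (fromDigits (suc m) δ <_) (*-comm (d ^ m) d)
    (*+-< (δ<d 0 z<s) (fromDigits-< m (δ ∘ suc) λ t t<m → δ<d (suc t) (s<s t<m)))

  digit-fromDigits : ∀ m δ → (∀ t → t < m → δ t < d) → ∀ t → t < m → digit (fromDigits m δ) t ≡ δ t
  digit-fromDigits (suc m) δ δ<d zero    _   = digit₀-*+ (fromDigits m (δ ∘ suc)) (δ<d 0 z<s)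
  digit-fromDigits (suc m) δ δ<d (suc t) t<m =
    trans (digitₛ-*+ (fromDigits m (δ ∘ suc)) t (δ<d 0 z<s))
          (digit-fromDigits m (δ ∘ suc) (λ t t<m → δ<d (suc t) (s<s t<m)) t (s<s⁻¹ t<m))

  complement : ℕ → ℕ
  complement v = d ∸ 1 ∸ v

  complement-< : ∀ v → complement v < d
  complement-< v = ∸1∸-< v (>-nonZero⁻¹ d)

  complement-involutive : ∀ {v} → v < d → complement (complement v) ≡ v
  complement-involutive v<d = m∸[m∸n]≡n (<⇒≤pred v<d)

  d^suc∸1∸≡ : ∀ m {a} → a < d ^ suc m → d ^ suc m ∸ 1 ∸ a ≡ (d ^ m ∸ 1 ∸ a / d) * d + complement (a % d)
  d^suc∸1∸≡ m {a} a<d^sm = begin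
    d * d ^ m ∸ 1 ∸ a                    ≡⟨ cong₂ (λ D b → D ∸ 1 ∸ b) (*-comm d (d ^ m)) a≡ ⟩
    d ^ m * d ∸ 1 ∸ (a / d * d + a % d)  ≡⟨ *+-complement (m%n<n a d) (/d-< m a<d^sm) ⟩
    (d ^ m ∸ 1 ∸ a / d) * d + complement (a % d) ∎
    where
    open ≡-Reasoning
    a≡ : a ≡ a / d * d + a % d
    a≡ = trans (m≡m%n+[m/n]*n a d) (+-comm (a % d) (a / d * d))

  digit-complement : ∀ m {a t} → a < d ^ m → t < m → digit (d ^ m ∸ 1 ∸ a) t ≡ complement (digit a t)
  digit-complement (suc m) {a} {zero}  a<d^m _   =
    trans (cong (λ b → digit b 0) (d^suc∸1∸≡ m a<d^m)) (digit₀-*+ (d ^ m ∸ 1 ∸ a / d) (complement-< (a % d)))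
  digit-complement (suc m) {a} {suc t} a<d^m t<m =
    trans (cong (λ b → digit b (suc t)) (d^suc∸1∸≡ m a<d^m))
          (trans (digitₛ-*+ (d ^ m ∸ 1 ∸ a / d) t (complement-< (a % d)))
                 (digit-complement m (/d-< m a<d^m) (s<s⁻¹ t<m)))

  complement^ : ℕ → ℕ → ℕ
  complement^ m v = iterate complement v m

  complement^-< : ∀ m {v} → v < d → complement^ m v < d
  complement^-< zero    v<d = v<d
  complement^-< (suc m) {v} _ = complement^-< m (complement-< v)

  complement^-involutive : ∀ m {v} → v < d → complement^ m (complement^ m v) ≡ v
  complement^-involutive zero    _   = refl
  complement^-involutive (suc m) {v} v<d = begin
    complement^ m (complement (complement^ m (complement v)))  ≡⟨ cong (complement^ m) (iterate-comm complement (complement v) m) ⟨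
    complement^ m (complement^ m (complement (complement v)))  ≡⟨ cong (λ w → complement^ m (complement^ m w)) (complement-involutive v<d) ⟩
    complement^ m (complement^ m v)                            ≡⟨ complement^-involutive m v<d ⟩
    v                                                          ∎
    where open ≡-Reasoning

  letter : ℕ → Fin d
  letter x = x mod d

  toℕ-letter : ∀ {x} → x < d → toℕ (letter x) ≡ x
  toℕ-letter {x} x<d = trans (toℕ-fromℕ< (m%n<n x d)) (m<n⇒m%n≡m x<d)

  letter-toℕ : ∀ y → letter (toℕ y) ≡ y
  letter-toℕ y = toℕ-injective (toℕ-letter (toℕ<n y))

tabulate-∷ʳ : ∀ {A : Set} {m} (g : Fin (suc m) → A) → tabulate g ≡ tabulate (g ∘ inject₁) ∷ʳ g (fromℕ m)
tabulate-∷ʳ {m = zero}  g = refl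
tabulate-∷ʳ {m = suc m} g = cong (g Fin.zero Vec.∷_) (tabulate-∷ʳ (g ∘ Fin.suc))

init-tabulate : ∀ {A : Set} {m} (g : Fin (suc m) → A) → init (tabulate g) ≡ tabulate (g ∘ inject₁)
init-tabulate {m = m} g = trans (cong init (tabulate-∷ʳ g)) (init-∷ʳ (g (fromℕ m)) (tabulate (g ∘ inject₁)))

drop-length-++ : ∀ {A : Set} (xs ys : List A) → drop (List.length xs) (xs ++ ys) ≡ ys
drop-length-++ []       ys = refl
drop-length-++ (x ∷ xs) ys = drop-length-++ xs ys

wordEq-refl : ∀ {d m} (xs : Vec (Fin d) m) → wordEq xs xs ≡ true
wordEq-refl Vec.[]       = refl
wordEq-refl (x Vec.∷ xs) = trans (cong (_∧ wordEq xs xs) (⌊⌋≡true (toℕ x ≟ toℕ x) refl)) (wordEq-refl xs)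

wordEq⇒≡ : ∀ {d m} (xs ys : Vec (Fin d) m) → wordEq xs ys ≡ true → xs ≡ ys
wordEq⇒≡ Vec.[]       Vec.[]       _ = refl
wordEq⇒≡ (x Vec.∷ xs) (y Vec.∷ ys) eq with toℕ x ≟ toℕ y
... | yes x≡y = cong₂ Vec._∷_ (toℕ-injective x≡y) (wordEq⇒≡ xs ys eq)

wordEq-decides : ∀ {d m} (xs ys : Vec (Fin d) m) → wordEq xs ys ≡ ⌊ ≡-dec Fin._≟_ xs ys ⌋
wordEq-decides xs ys with ≡-dec Fin._≟_ xs ys
... | yes refl = wordEq-refl xs
... | no xs≢ys with wordEq xs ys in eq
...   | true  = ⊥-elim (xs≢ys (wordEq⇒≡ xs ys eq))
...   | false = refl

module DeBruijn {d n₁ : ℕ} where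

  Word : Set
  Word = Vec (Fin d) (suc n₁)

  shift : Word → Fin d → Word
  shift u x = tail u ∷ʳ x

  B-arcs : ∀ u v → arcs (B d (suc n₁)) u v ≡ 𝟙 ⌊ ≡-dec Fin._≟_ (tail u) (init v) ⌋
  B-arcs u v = cong 𝟙 (wordEq-decides (tail u) (init v))

  B-arc-shift : ∀ u x → arcs (B d (suc n₁)) u (shift u x) ≡ 1
  B-arc-shift u x = cong 𝟙 (trans (cong (wordEq (tail u)) (init-∷ʳ x (tail u))) (wordEq-refl (tail u)))

  walk-shifts : ∀ u xs → Walk (B d (suc n₁)) (List.length xs) u (foldl shift u xs)
  walk-shifts u []       = []
  walk-shifts u (x ∷ xs) = (λ arc≡0 → 1≢0 (trans (sym (B-arc-shift u x)) arc≡0)) ∷ walk-shifts (shift u x) xs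
    where
    1≢0 : 1 ≢ 0
    1≢0 ()

  toList-shifts : ∀ u xs → toList (foldl shift u xs) ≡ drop (List.length xs) (toList u ++ xs)
  toList-shifts u           []       = sym (++-identityʳ (toList u))
  toList-shifts (y Vec.∷ u) (x ∷ xs) = begin
    toList (foldl shift (u ∷ʳ x) xs)                       ≡⟨ toList-shifts (u ∷ʳ x) xs ⟩
    drop (List.length xs) (toList (u ∷ʳ x) ++ xs)           ≡⟨ cong (λ l → drop (List.length xs) (l ++ xs)) (toList-∷ʳ x u) ⟩
    drop (List.length xs) ((toList u ++ List.[ x ]) ++ xs)  ≡⟨ cong (drop (List.length xs)) (++-assoc (toList u) List.[ x ] xs) ⟩
    drop (List.length xs) (toList u ++ x ∷ xs)              ≡⟨ drop-drop 1 (List.length xs) (y ∷ toList u ++ x ∷ xs) ⟩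
    drop (suc (List.length xs)) (y ∷ toList u ++ x ∷ xs)    ∎
    where open ≡-Reasoning

  shifts-toList : ∀ u v → foldl shift u (toList v) ≡ v
  shifts-toList u v = trans (sym (cast-is-id refl _)) (toList-injective refl _ v (begin
    toList (foldl shift u (toList v))                        ≡⟨ toList-shifts u (toList v) ⟩
    drop (List.length (toList v)) (toList u ++ toList v)     ≡⟨ cong (λ m → drop m (toList u ++ toList v)) same-length ⟩
    drop (List.length (toList u)) (toList u ++ toList v)     ≡⟨ drop-length-++ (toList u) (toList v) ⟩
    toList v                                                 ∎))
    where
    open ≡-Reasoning
    same-length : List.length (toList v) ≡ List.length (toList u)
    same-length = trans (length-toList v) (sym (length-toList u))

  B-walk : ∀ u v → Walk (B d (suc n₁)) (suc n₁) u v
  B-walk u v = subst₂ (λ m w → Walk (B d (suc n₁)) m u w) (length-toList v) (shifts-toList u v) (walk-shifts u (toList v))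

  reverse-shift : ∀ u x → reverse (shift u x) ≡ x Vec.∷ init (reverse u)
  reverse-shift u x = begin
    reverse (tail u ∷ʳ x)      ≡⟨ reverse-reverse (trans (reverse-∷ x (reverse (tail u))) (cong (_∷ʳ x) (reverse-involutive (tail u)))) ⟩
    x Vec.∷ reverse (tail u)   ≡⟨ cong (x Vec.∷_) (init-reverse u) ⟨
    x Vec.∷ init (reverse u)   ∎
    where open ≡-Reasoning

  module _ .{{_ : NonZero d}} where
    open Digits d using (letter; letter-toℕ; toℕ-letter)

    B-arcs-count : (enc : Word → ℕ) → (∀ {u v} → enc u ≡ enc v → u ≡ v) → ∀ u v →
                   ∑[ x < d ] 𝟙 ⌊ enc (shift u (letter x)) ≟ enc v ⌋ ≡ arcs (B d (suc n₁)) u v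
    B-arcs-count enc enc-injective u v = trans (count (≡-dec Fin._≟_ (tail u) (init v))) (sym (B-arcs u v))
      where
      shift≡⇒ : ∀ {y} → shift u y ≡ v → tail u ≡ init v
      shift≡⇒ {y} eq = trans (sym (init-∷ʳ y (tail u))) (cong init eq)

      count : (tail≟init : Dec (tail u ≡ init v)) → ∑[ x < d ] 𝟙 ⌊ enc (shift u (letter x)) ≟ enc v ⌋ ≡ 𝟙 ⌊ tail≟init ⌋
      count (no tail≢init) = sumBelow-zero d λ x _ →
        cong 𝟙 (⌊⌋≡false (enc (shift u (letter x)) ≟ enc v) (tail≢init ∘ shift≡⇒ ∘ enc-injective))
      count (yes tail≡init) = trans (sumBelow-single d _ (toℕ<n (last v)) others)
        (cong 𝟙 (⌊⌋≡true (_ ≟ enc v) (cong enc (trans (cong (shift u) (letter-toℕ (last v))) (sym v≡shift-last)))))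
        where
        v≡shift-last : v ≡ shift u (last v)
        v≡shift-last = trans (proj₂ (proj₂ (Vec.initLast v))) (cong (_∷ʳ last v) (sym tail≡init))
        others : ∀ x → x < d → x ≢ toℕ (last v) → 𝟙 ⌊ enc (shift u (letter x)) ≟ enc v ⌋ ≡ 0
        others x x<d x≢last = cong 𝟙 (⌊⌋≡false (_ ≟ enc v) λ eq → x≢last (begin
          x                    ≡⟨ toℕ-letter x<d ⟨
          toℕ (letter x)       ≡⟨ cong toℕ (∷ʳ-injectiveʳ (tail u) (tail u) (trans (enc-injective eq) v≡shift-last)) ⟩
          toℕ (last v)         ∎))
          where open ≡-Reasoning

antitranspose : (p q : ℕ) .{{_ : NonZero q}} → ℕ → ℕ
antitranspose p q a = (q ∸ 1 ∸ a % q) * p + (p ∸ 1 ∸ a / q)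

antitranspose-< : ∀ p q .{{_ : NonZero q}} a → 0 < p → antitranspose p q a < q * p
antitranspose-< p q a 0<p = *+-< (∸1∸-< (a / q) 0<p) (∸1∸-< (a % q) (>-nonZero⁻¹ q))

H-arcs : ∀ {p q d} .{{_ : NonZero q}} .{{_ : NonZero d}} → d ∣ p * q → ∀ k l →
         arcs (H p q d) k l ≡ ∑[ x < d ] 𝟙 ⌊ antitranspose p q (toℕ k * d + x) / d ≟ toℕ l ⌋
H-arcs {p} {q} {d} d∣pq k l = begin
  countPairs p q arc?                              ≡⟨ countPairs≡sumBelow p q arc? ⟩
  ∑[ i < p ] ∑[ j < q ] 𝟙 (arc? i j)              ≡⟨ sumBelow-cong p (λ i _ → sumBelow-cong q λ j j<q → cong 𝟙 (arc?≡ i j<q)) ⟩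
  ∑[ i < p ] ∑[ j < q ] G (i * q + j)             ≡⟨ sumBelow-* p q G ⟩
  sumBelow (p * q) G                               ≡⟨ cong (λ m → sumBelow m G) (m/n*n≡m d∣pq) ⟨
  sumBelow (p * q / d * d) G                       ≡⟨ sumBelow-* (p * q / d) d G ⟨
  ∑[ k′ < p * q / d ] ∑[ x < d ] G (k′ * d + x)   ≡⟨ sumBelow-single (p * q / d) _ (toℕ<n k) other-blocks ⟩
  ∑[ x < d ] G (K * d + x)                        ≡⟨ sumBelow-cong d (λ x x<d → G-block K x<d) ⟩
  ∑[ x < d ] 𝟙 (⌊ K ≟ K ⌋ ∧ target (K * d + x))   ≡⟨ sumBelow-cong d (λ x _ → cong (λ b → 𝟙 (b ∧ target (K * d + x))) (⌊⌋≡true (K ≟ K) refl)) ⟩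
  ∑[ x < d ] 𝟙 (target (K * d + x))               ∎
  where
  open ≡-Reasoning
  K = toℕ k
  arc? : ℕ → ℕ → Bool
  arc? i j = ⌊ (i * q + j) / d ≟ K ⌋ ∧ ⌊ ((q ∸ 1 ∸ j) * p + (p ∸ 1 ∸ i)) / d ≟ toℕ l ⌋
  target : ℕ → Bool
  target a = ⌊ antitranspose p q a / d ≟ toℕ l ⌋
  G : ℕ → ℕ
  G a = 𝟙 (⌊ a / d ≟ K ⌋ ∧ target a)
  arc?≡ : ∀ i {j} → j < q → arc? i j ≡ (⌊ (i * q + j) / d ≟ K ⌋ ∧ target (i * q + j))
  arc?≡ i {j} j<q = cong₂ (λ j′ i′ → ⌊ (i * q + j) / d ≟ K ⌋ ∧ ⌊ ((q ∸ 1 ∸ j′) * p + (p ∸ 1 ∸ i′)) / d ≟ toℕ l ⌋)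
                      (sym ([m*n+o]%n≡o i j<q)) (sym ([m*n+o]/n≡m i j<q))
  G-block : ∀ k′ {x} → x < d → G (k′ * d + x) ≡ 𝟙 (⌊ k′ ≟ K ⌋ ∧ target (k′ * d + x))
  G-block k′ {x} x<d = cong (λ b → 𝟙 (⌊ b ≟ K ⌋ ∧ target (k′ * d + x))) ([m*n+o]/n≡m k′ x<d)
  other-blocks : ∀ k′ → k′ < p * q / d → k′ ≢ K → ∑[ x < d ] G (k′ * d + x) ≡ 0
  other-blocks k′ _ k′≢K = sumBelow-zero d λ x x<d →
    trans (G-block k′ x<d) (cong (λ b → 𝟙 (b ∧ target (k′ * d + x))) (⌊⌋≡false (k′ ≟ K) k′≢K))

module H-powers (d : ℕ) .{{_ : NonZero d}} (n₁ P Q : ℕ) (P+Q≡N : P + Q ≡ 2 + n₁) where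
  open Digits d
  open DeBruijn {d} {n₁}

  n N p q : ℕ
  n = suc n₁
  N = suc n
  p = d ^ P
  q = d ^ Q

  instance
    q-nonZero : NonZero q
    q-nonZero = m^n≢0 d Q

  p*q≡d^n*d : p * q ≡ d ^ n * d
  p*q≡d^n*d = trans (sym (^-distribˡ-+-* d P Q)) (trans (cong (d ^_) P+Q≡N) (*-comm d (d ^ n)))

  p*q/d≡d^n : p * q / d ≡ d ^ n
  p*q/d≡d^n = trans (cong (_/ d) p*q≡d^n*d) (m*n/n≡m (d ^ n) d)

  toℕ<d^n : (k : Fin (p * q / d)) → toℕ k < d ^ n
  toℕ<d^n k = subst (toℕ k <_) p*q/d≡d^n (toℕ<n k)

  vertex : ∀ {k} → k < d ^ n → Fin (p * q / d)
  vertex {k} k<d^n = fromℕ< (subst (k <_) (sym p*q/d≡d^n) k<d^n)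

  toℕ-vertex : ∀ {k} (k<d^n : k < d ^ n) → toℕ (vertex k<d^n) ≡ k
  toℕ-vertex k<d^n = toℕ-fromℕ< _

  /%-split : ∀ a → a ≡ a / q * q + a % q
  /%-split a = trans (m≡m%n+[m/n]*n a q) (+-comm (a % q) (a / q * q))

  rotate : ℕ → ℕ
  rotate s = (s + Q) % N

  rotate-< : ∀ s → rotate s < N
  rotate-< s = m%n<n (s + Q) N

  rotate-low : ∀ {s} → s < P → rotate s ≡ Q + s
  rotate-low {s} s<P = trans (m<n⇒m%n≡m (subst (s + Q <_) P+Q≡N (+-monoˡ-< Q s<P))) (+-comm s Q)

  rotate-high : ∀ {r} → r < Q → rotate (P + r) ≡ r
  rotate-high {r} r<Q = begin
    (P + r + Q) % N    ≡⟨ cong (_% N) (trans (cong (_+ Q) (+-comm P r)) (trans (+-assoc r P Q) (cong (r +_) P+Q≡N))) ⟩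
    (r + N) % N        ≡⟨ [m+n]%n≡m%n r N ⟩
    r % N              ≡⟨ m<n⇒m%n≡m (<-≤-trans r<Q (subst (Q ≤_) P+Q≡N (m≤n+m Q P))) ⟩
    r                  ∎
    where open ≡-Reasoning

  digit-antitranspose-low : ∀ {a s} → a < p * q → s < P → digit (antitranspose p q a) s ≡ complement (digit a (Q + s))
  digit-antitranspose-low {a} {s} a<pq s<P = begin
    digit ((q ∸ 1 ∸ j) * p + (p ∸ 1 ∸ i)) s  ≡⟨ digit-low P {q ∸ 1 ∸ j} s<P (∸1∸-< i (m^n>0 d P)) ⟩
    digit (p ∸ 1 ∸ i) s                      ≡⟨ digit-complement P (m<n*o⇒m/o<n a<pq) s<P ⟩
    complement (digit i s)                   ≡⟨ cong complement (digit-high Q {i} s (m%n<n a q)) ⟨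
    complement (digit (i * q + j) (Q + s))   ≡⟨ cong (λ b → complement (digit b (Q + s))) (/%-split a) ⟨
    complement (digit a (Q + s))             ∎
    where
    open ≡-Reasoning
    i = a / q
    j = a % q

  digit-antitranspose-high : ∀ {a r} → a < p * q → r < Q → digit (antitranspose p q a) (P + r) ≡ complement (digit a r)
  digit-antitranspose-high {a} {r} a<pq r<Q = begin
    digit ((q ∸ 1 ∸ j) * p + (p ∸ 1 ∸ i)) (P + r)  ≡⟨ digit-high P {q ∸ 1 ∸ j} r (∸1∸-< i (m^n>0 d P)) ⟩
    digit (q ∸ 1 ∸ j) r                            ≡⟨ digit-complement Q (m%n<n a q) r<Q ⟩
    complement (digit j r)                         ≡⟨ cong complement (digit-low Q {i} r<Q (m%n<n a q)) ⟨
    complement (digit (i * q + j) r)               ≡⟨ cong (λ b → complement (digit b r)) (/%-split a) ⟨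
    complement (digit a r)                         ∎
    where
    open ≡-Reasoning
    i = a / q
    j = a % q

  digit-antitranspose : ∀ {a s} → a < p * q → s < N → digit (antitranspose p q a) s ≡ complement (digit a (rotate s))
  digit-antitranspose {a} {s} a<pq s<N with s <? P
  ... | yes s<P = trans (digit-antitranspose-low a<pq s<P) (cong (complement ∘ digit a) (sym (rotate-low s<P)))
  ... | no  s≮P = begin
    digit (antitranspose p q a) s        ≡⟨ cong (digit (antitranspose p q a)) s≡P+r ⟨
    digit (antitranspose p q a) (P + r)  ≡⟨ digit-antitranspose-high a<pq r<Q ⟩
    complement (digit a r)               ≡⟨ cong (complement ∘ digit a) (trans (sym (rotate-high r<Q)) (cong rotate s≡P+r)) ⟩
    complement (digit a (rotate s))      ∎
    where
    open ≡-Reasoning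
    r = s ∸ P
    s≡P+r : P + r ≡ s
    s≡P+r = m+[n∸m]≡n (≮⇒≥ s≮P)
    r<Q : r < Q
    r<Q = +-cancelˡ-< P r Q (subst₂ _<_ (sym s≡P+r) (sym P+Q≡N) s<N)

  step : ℕ → ℕ → ℕ
  step k x = antitranspose p q (k * d + x) / d

  step-< : ∀ k x → step k x < d ^ n
  step-< k x = m<n*o⇒m/o<n (subst (antitranspose p q (k * d + x) <_) (trans (*-comm q p) p*q≡d^n*d)
                                  (antitranspose-< p q (k * d + x) (m^n>0 d P)))

  digit-step : ∀ {k x t} → k < d ^ n → x < d → t < n → digit (step k x) t ≡ complement (digit (k * d + x) (rotate (suc t)))
  digit-step {k} {x} k<d^n x<d t<n = digit-antitranspose (subst (k * d + x <_) (sym p*q≡d^n*d) (*+-< x<d k<d^n)) (s<s t<n)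

  H-arcs-step : ∀ k l → arcs (H p q d) k l ≡ ∑[ x < d ] 𝟙 ⌊ step (toℕ k) x ≟ toℕ l ⌋
  H-arcs-step = H-arcs {p} {q} {d} (divides (d ^ n) p*q≡d^n*d)

  H-arc⇒step : ∀ {k l} → arcs (H p q d) k l ≢ 0 → ∃[ x ] x < d × step (toℕ k) x ≡ toℕ l
  H-arc⇒step {k} {l} arc≢0 with sumBelow≢0 d _ (λ ∑≡0 → arc≢0 (trans (H-arcs-step k l) ∑≡0))
  ... | x , x<d , 𝟙≢0 = x , x<d , 𝟙≢0⇒ (step (toℕ k) x ≟ toℕ l) 𝟙≢0

  module CommonDivisor {g : ℕ} (g∣P : g ∣ P) (g∣Q : g ∣ Q) where

    rotate-∤ : ∀ {s} → ¬ g ∣ s → ¬ g ∣ rotate s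
    rotate-∤ {s} g∤s g∣rot = g∤s (∣m+n∣m⇒∣n (subst (g ∣_) (+-comm s Q) (∣n∣m%n⇒∣m g∣N g∣rot)) g∣Q)
      where
      g∣N : g ∣ N
      g∣N = subst (g ∣_) P+Q≡N (∣m∣n⇒∣m+n g∣P g∣Q)

    rotate-suc-∤ : ∀ {t} → ¬ g ∣ suc t → ∃[ t′ ] t′ < n × ¬ g ∣ suc t′ × rotate (suc t) ≡ suc t′
    rotate-suc-∤ {t} g∤ with rotate (suc t) in rot≡ | rotate-∤ g∤
    ... | zero   | g∤0  = ⊥-elim (g∤0 (g ∣0))
    ... | suc t′ | g∤t′ = t′ , s<s⁻¹ (subst (_< N) rot≡ (rotate-< (suc t))) , g∤t′ , refl

    -- The label of an arc enters at place 0, and rotate maps places not divisible by g to such places.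
    walk-digit : ∀ {m k l} → Walk (H p q d) m k l → ∀ {t} → t < n → ¬ g ∣ suc t →
                 ∃[ t′ ] t′ < n × ¬ g ∣ suc t′ × digit (toℕ l) t ≡ complement^ m (digit (toℕ k) t′)
    walk-digit []                {t} t<n g∤ = t , t<n , g∤ , refl
    walk-digit {suc m} {k} (arc ∷ ω) t<n g∤
      with walk-digit ω t<n g∤ | H-arc⇒step arc
    ... | t₁ , t₁<n , g∤₁ , digit≡ | x , x<d , step≡
      with rotate-suc-∤ g∤₁
    ...   | t₂ , t₂<n , g∤₂ , rot≡ = t₂ , t₂<n , g∤₂ , (begin
      _                                                      ≡⟨ digit≡ ⟩
      complement^ m (digit _ t₁)                             ≡⟨ cong (λ b → complement^ m (digit b t₁)) step≡ ⟨
      complement^ m (digit (step K x) t₁)                    ≡⟨ cong (complement^ m) (digit-step (toℕ<d^n k) x<d t₁<n) ⟩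
      complement^ m (complement (digit (K * d + x) (rotate (suc t₁))))
                                                             ≡⟨ cong (λ s → complement^ m (complement (digit (K * d + x) s))) rot≡ ⟩
      complement^ m (complement (digit (K * d + x) (suc t₂))) ≡⟨ cong (complement^ m ∘ complement) (digitₛ-*+ K t₂ x<d) ⟩
      complement^ (suc m) (digit K t₂)                       ∎)
      where
      open ≡-Reasoning
      K = toℕ k

    ¬B≅H : g ≢ 1 → 1 < d → ¬ (B d n ≅ H p q d)
    ¬B≅H g≢1 1<d iso@(σ , _) = 1≢0 (walk⇒1≡0 (walk-digit ω z<s (g≢1 ∘ ∣1⇒≡1)))
      where
      open Inverse σ
      open ≡-Reasoning
      1≢0 : 1 ≢ 0
      1≢0 ()
      1<d^n : 1 < d ^ n
      1<d^n = <-≤-trans 1<d (m≤m*n d (d ^ n₁) ⦃ m^n≢0 d n₁ ⦄)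
      v₀ v₁ : Fin (p * q / d)
      v₀ = vertex (<-trans z<s 1<d^n)
      v₁ = vertex 1<d^n
      ω : Walk (H p q d) (n + n) v₀ v₁
      ω = subst₂ (Walk (H p q d) (n + n)) (strictlyInverseˡ v₀) (strictlyInverseˡ v₁)
                 (≅-Walk iso (B-walk (from v₀) (from v₁) ++ʷ B-walk (from v₁) (from v₁)))
      walk⇒1≡0 : ∃[ t′ ] t′ < n × ¬ g ∣ suc t′ × digit (toℕ v₁) 0 ≡ complement^ (n + n) (digit (toℕ v₀) t′) → 1 ≡ 0
      walk⇒1≡0 (t′ , _ , _ , digit≡) = begin
        1                                           ≡⟨ m<n⇒m%n≡m 1<d ⟨
        digit 1 0                                   ≡⟨ cong (λ b → digit b 0) (toℕ-vertex 1<d^n) ⟨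
        digit (toℕ v₁) 0                            ≡⟨ digit≡ ⟩
        complement^ (n + n) (digit (toℕ v₀) t′)     ≡⟨ cong (λ b → complement^ (n + n) (digit b t′)) (toℕ-vertex (<-trans z<s 1<d^n)) ⟩
        complement^ (n + n) (digit 0 t′)            ≡⟨ cong (complement^ (n + n)) (digit[0] t′) ⟩
        complement^ (n + n) 0                       ≡⟨ iterate-+ complement 0 n n ⟩
        complement^ n (complement^ n 0)             ≡⟨ complement^-involutive n (>-nonZero⁻¹ d) ⟩
        0                                           ∎

  -- A word is read youngest letter first, i.e. reversed; its letter at index i was shifted in
  -- i + 1 steps ago and is stored, complemented i + 1 times, at digit slot i = position (i + 1) − 1.
  module ModularInverse {e : ℕ} (e*P≡1 : e * P % N ≡ 1) where

    position age : ℕ → ℕ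
    position j = j * P % N
    age s = s * e % N

    *e*P≡ : ∀ m → m * (e * P) % N ≡ m % N
    *e*P≡ m = begin
      m * (e * P) % N              ≡⟨ %-distribˡ-* m (e * P) N ⟩
      m % N * (e * P % N) % N      ≡⟨ cong (λ r → m % N * r % N) e*P≡1 ⟩
      m % N * 1 % N                ≡⟨ cong (_% N) (*-identityʳ (m % N)) ⟩
      m % N % N                    ≡⟨ m%n%n≡m%n m N ⟩
      m % N                        ∎
      where open ≡-Reasoning

    position-age : ∀ {s} → s < N → position (age s) ≡ s
    position-age {s} s<N = begin
      s * e % N * P % N  ≡⟨ [m%n*o]%n≡[m*o]%n (s * e) P N ⟩
      s * e * P % N      ≡⟨ cong (_% N) (*-assoc s e P) ⟩
      s * (e * P) % N    ≡⟨ *e*P≡ s ⟩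
      s % N              ≡⟨ m<n⇒m%n≡m s<N ⟩
      s                  ∎
      where open ≡-Reasoning

    age-position : ∀ {j} → j < N → age (position j) ≡ j
    age-position {j} j<N = begin
      j * P % N * e % N  ≡⟨ [m%n*o]%n≡[m*o]%n (j * P) e N ⟩
      j * P * e % N      ≡⟨ cong (_% N) (trans (*-assoc j P e) (cong (j *_) (*-comm P e))) ⟩
      j * (e * P) % N    ≡⟨ *e*P≡ j ⟩
      j % N              ≡⟨ m<n⇒m%n≡m j<N ⟩
      j                  ∎
      where open ≡-Reasoning

    position≢0 : ∀ {j} → 0 < j → j < N → position j ≢ 0
    position≢0 {suc j} _ j<N pos≡0 = 1+n≢0 (trans (sym (age-position j<N)) (cong age pos≡0))

    age≢0 : ∀ {s} → 0 < s → s < N → age s ≢ 0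
    age≢0 {suc s} _ s<N age≡0 = 1+n≢0 (trans (sym (position-age s<N)) (cong position age≡0))

    rotate-position : ∀ j → rotate (position (suc j)) ≡ position j
    rotate-position j = begin
      (suc j * P % N + Q) % N   ≡⟨ [m%n+o]%n≡[m+o]%n (suc j * P) Q N ⟩
      (P + j * P + Q) % N       ≡⟨ cong (_% N) (trans (cong (_+ Q) (+-comm P (j * P))) (trans (+-assoc (j * P) P Q) (cong (j * P +_) P+Q≡N))) ⟩
      (j * P + N) % N           ≡⟨ [m+n]%n≡m%n (j * P) N ⟩
      j * P % N                 ∎
      where open ≡-Reasoning

    pred<n : ∀ {m} → m < N → pred m < n
    pred<n {zero}  _   = z<s
    pred<n {suc m} m<N = s<s⁻¹ m<N

    slot : ℕ → ℕ
    slot i = pred (position (suc i))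

    wordIndex : ℕ → Fin n
    wordIndex t = fromℕ< (pred<n (m%n<n (suc t * e) N))

    slot-< : ∀ i → slot i < n
    slot-< i = pred<n (m%n<n (suc i * P) N)

    suc-slot : ∀ {i} → i < n → suc (slot i) ≡ position (suc i)
    suc-slot {i} i<n = suc-pred (position (suc i)) ⦃ ≢-nonZero (position≢0 z<s (s<s i<n)) ⦄

    slot-wordIndex : ∀ {t} → t < n → slot (toℕ (wordIndex t)) ≡ t
    slot-wordIndex {t} t<n = begin
      pred (position (suc (toℕ (wordIndex t))))  ≡⟨ cong (λ i → pred (position (suc i))) (toℕ-fromℕ< (pred<n (m%n<n (suc t * e) N))) ⟩
      pred (position (suc (pred (age (suc t)))))  ≡⟨ cong (pred ∘ position) (suc-pred (age (suc t)) ⦃ ≢-nonZero (age≢0 z<s (s<s t<n)) ⦄) ⟩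
      pred (position (age (suc t)))               ≡⟨ cong pred (position-age (s<s t<n)) ⟩
      t                                           ∎
      where open ≡-Reasoning

    wordIndex-slot : ∀ i → wordIndex (slot (toℕ i)) ≡ i
    wordIndex-slot i = toℕ-injective (begin
      toℕ (wordIndex (slot (toℕ i)))       ≡⟨ toℕ-fromℕ< _ ⟩
      pred (age (suc (slot (toℕ i))))      ≡⟨ cong (pred ∘ age) (suc-slot (toℕ<n i)) ⟩
      pred (age (position (suc (toℕ i))))  ≡⟨ cong pred (age-position (s<s (toℕ<n i))) ⟩
      toℕ i                                ∎)
      where open ≡-Reasoning

    rotate-slot-0 : rotate (suc (slot 0)) ≡ 0
    rotate-slot-0 = trans (cong rotate (suc-slot z<s)) (rotate-position 0)

    rotate-slot-suc : ∀ {i} → suc i < n → rotate (suc (slot (suc i))) ≡ suc (slot i)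
    rotate-slot-suc {i} i+1<n = trans (cong rotate (suc-slot i+1<n)) (trans (rotate-position (suc i)) (sym (suc-slot (<-trans (n<1+n i) i+1<n))))

    ageLetter : ℕ → Fin n → Fin d
    ageLetter k i = letter (complement^ (suc (toℕ i)) (digit k (slot (toℕ i))))

    toAgeWord : ℕ → Vec (Fin d) n
    toAgeWord k = tabulate (ageLetter k)

    fromAgeWord : Vec (Fin d) n → ℕ
    fromAgeWord w = fromDigits n λ t → complement^ (suc (toℕ (wordIndex t))) (toℕ (lookup w (wordIndex t)))

    fromAgeWord-< : ∀ w → fromAgeWord w < d ^ n
    fromAgeWord-< w = fromDigits-< n _ λ t _ → complement^-< (suc (toℕ (wordIndex t))) (toℕ<n (lookup w (wordIndex t)))

    digit-fromAgeWord : ∀ w {t} → t < n →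
                        digit (fromAgeWord w) t ≡ complement^ (suc (toℕ (wordIndex t))) (toℕ (lookup w (wordIndex t)))
    digit-fromAgeWord w t<n = digit-fromDigits n _ (λ t _ → complement^-< (suc (toℕ (wordIndex t))) (toℕ<n (lookup w (wordIndex t)))) _ t<n

    fromAgeWord-toAgeWord : ∀ {k} → k < d ^ n → fromAgeWord (toAgeWord k) ≡ k
    fromAgeWord-toAgeWord {k} k<d^n = digit-injective n (fromAgeWord-< (toAgeWord k)) k<d^n λ t t<n →
      let i = toℕ (wordIndex t) in begin
      digit (fromAgeWord (toAgeWord k)) t                                 ≡⟨ digit-fromAgeWord (toAgeWord k) t<n ⟩
      complement^ (suc i) (toℕ (lookup (toAgeWord k) (wordIndex t)))      ≡⟨ cong (complement^ (suc i) ∘ toℕ) (lookup∘tabulate (ageLetter k) (wordIndex t)) ⟩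
      complement^ (suc i) (toℕ (letter (complement^ (suc i) (digit k (slot i)))))
                                                                           ≡⟨ cong (complement^ (suc i)) (toℕ-letter (complement^-< (suc i) (digit-< k (slot i)))) ⟩
      complement^ (suc i) (complement^ (suc i) (digit k (slot i)))        ≡⟨ complement^-involutive (suc i) (digit-< k (slot i)) ⟩
      digit k (slot i)                                                    ≡⟨ cong (digit k) (slot-wordIndex t<n) ⟩
      digit k t                                                           ∎
      where open ≡-Reasoning

    toAgeWord-fromAgeWord : ∀ w → toAgeWord (fromAgeWord w) ≡ w
    toAgeWord-fromAgeWord w = trans (tabulate-cong λ i → let j = toℕ i in begin
      letter (complement^ (suc j) (digit (fromAgeWord w) (slot j)))     ≡⟨ cong (letter ∘ complement^ (suc j)) (digit-fromAgeWord w (slot-< j)) ⟩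
      letter (complement^ (suc j) (complement^ (suc (toℕ (wordIndex (slot j)))) (toℕ (lookup w (wordIndex (slot j))))))
                                                                          ≡⟨ cong (λ i′ → letter (complement^ (suc j) (complement^ (suc (toℕ i′)) (toℕ (lookup w i′))))) (wordIndex-slot i) ⟩
      letter (complement^ (suc j) (complement^ (suc j) (toℕ (lookup w i))))
                                                                          ≡⟨ cong letter (complement^-involutive (suc j) (toℕ<n (lookup w i))) ⟩
      letter (toℕ (lookup w i))                                           ≡⟨ letter-toℕ (lookup w i) ⟩
      lookup w i                                                          ∎) (tabulate∘lookup w)
      where open ≡-Reasoning

    toAgeWord-step : ∀ {k x} → k < d ^ n → x < d → toAgeWord (step k x) ≡ letter x Vec.∷ init (toAgeWord k)
    toAgeWord-step {k} {x} k<d^n x<d = begin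
      tabulate (ageLetter (step k x))               ≡⟨ cong₂ Vec._∷_ newest older ⟩
      letter x Vec.∷ tabulate (ageLetter k ∘ inject₁) ≡⟨ cong (letter x Vec.∷_) (init-tabulate (ageLetter k)) ⟨
      letter x Vec.∷ init (toAgeWord k)             ∎
      where
      open ≡-Reasoning
      a = k * d + x
      newest : ageLetter (step k x) Fin.zero ≡ letter x
      newest = cong letter (begin
        complement (digit (step k x) (slot 0))                    ≡⟨ cong complement (digit-step k<d^n x<d (slot-< 0)) ⟩
        complement (complement (digit a (rotate (suc (slot 0))))) ≡⟨ complement-involutive (digit-< a (rotate (suc (slot 0)))) ⟩
        digit a (rotate (suc (slot 0)))                           ≡⟨ cong (digit a) rotate-slot-0 ⟩
        digit a 0                                                 ≡⟨ digit₀-*+ k x<d ⟩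
        x                                                         ∎)
      older : tabulate (ageLetter (step k x) ∘ Fin.suc) ≡ tabulate (ageLetter k ∘ inject₁)
      older = tabulate-cong λ i → let j = toℕ i in cong letter (begin
        complement^ (2 + j) (digit (step k x) (slot (suc j)))
          ≡⟨ cong (complement^ (2 + j)) (digit-step k<d^n x<d (slot-< (suc j))) ⟩
        complement^ (2 + j) (complement (digit a (rotate (suc (slot (suc j))))))
          ≡⟨ cong (λ s → complement^ (2 + j) (complement (digit a s))) (rotate-slot-suc (s<s (toℕ<n i))) ⟩
        complement^ (2 + j) (complement (digit a (suc (slot j))))
          ≡⟨ cong (complement^ (2 + j) ∘ complement) (digitₛ-*+ k (slot j) x<d) ⟩
        complement^ (suc j) (complement (complement (digit k (slot j))))
          ≡⟨ cong (complement^ (suc j)) (complement-involutive (digit-< k (slot j))) ⟩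
        complement^ (suc j) (digit k (slot j))
          ≡⟨ cong (λ j′ → complement^ (suc j′) (digit k (slot j′))) (toℕ-inject₁ i) ⟨
        complement^ (suc (toℕ (inject₁ i))) (digit k (slot (toℕ (inject₁ i)))) ∎)

    encode : Word → ℕ
    encode u = fromAgeWord (reverse u)

    decode : ℕ → Word
    decode k = reverse (toAgeWord k)

    decode-encode : ∀ u → decode (encode u) ≡ u
    decode-encode u = trans (cong reverse (toAgeWord-fromAgeWord (reverse u))) (reverse-involutive u)

    encode-decode : ∀ {k} → k < d ^ n → encode (decode k) ≡ k
    encode-decode {k} k<d^n = trans (cong fromAgeWord (reverse-involutive (toAgeWord k))) (fromAgeWord-toAgeWord k<d^n)

    encode-injective : ∀ {u v} → encode u ≡ encode v → u ≡ v
    encode-injective {u} {v} eq = trans (sym (decode-encode u)) (trans (cong decode eq) (decode-encode v))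

    decode-step : ∀ {k x} → k < d ^ n → x < d → decode (step k x) ≡ shift (decode k) (letter x)
    decode-step {k} {x} k<d^n x<d = begin
      reverse (toAgeWord (step k x))                          ≡⟨ cong reverse (toAgeWord-step k<d^n x<d) ⟩
      reverse (letter x Vec.∷ init (toAgeWord k))             ≡⟨ cong (λ w → reverse (letter x Vec.∷ init w)) (reverse-involutive (toAgeWord k)) ⟨
      reverse (letter x Vec.∷ init (reverse (decode k)))      ≡⟨ reverse-reverse (reverse-shift (decode k) (letter x)) ⟩
      shift (decode k) (letter x)                             ∎
      where open ≡-Reasoning

    step-encode : ∀ u {x} → x < d → step (encode u) x ≡ encode (shift u (letter x))
    step-encode u {x} x<d = begin
      step (encode u) x                            ≡⟨ encode-decode (step-< (encode u) x) ⟨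
      encode (decode (step (encode u) x))          ≡⟨ cong encode (decode-step (fromAgeWord-< (reverse u)) x<d) ⟩
      encode (shift (decode (encode u)) (letter x)) ≡⟨ cong (λ v → encode (shift v (letter x))) (decode-encode u) ⟩
      encode (shift u (letter x))                  ∎
      where open ≡-Reasoning

    toVertex : Word → Fin (p * q / d)
    toVertex u = vertex (fromAgeWord-< (reverse u))

    toℕ-toVertex : ∀ u → toℕ (toVertex u) ≡ encode u
    toℕ-toVertex u = toℕ-vertex (fromAgeWord-< (reverse u))

    B≅H : B d n ≅ H p q d
    B≅H = mk↔ₛ′ toVertex (decode ∘ toℕ) to-from from-to , arcs-preserved
      where
      to-from : ∀ k → toVertex (decode (toℕ k)) ≡ k
      to-from k = toℕ-injective (trans (toℕ-toVertex (decode (toℕ k))) (encode-decode (toℕ<d^n k)))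
      from-to : ∀ u → decode (toℕ (toVertex u)) ≡ u
      from-to u = trans (cong decode (toℕ-toVertex u)) (decode-encode u)
      arcs-preserved : ∀ u v → arcs (H p q d) (toVertex u) (toVertex v) ≡ arcs (B d n) u v
      arcs-preserved u v = begin
        arcs (H p q d) (toVertex u) (toVertex v)                        ≡⟨ H-arcs-step (toVertex u) (toVertex v) ⟩
        ∑[ x < d ] 𝟙 ⌊ step (toℕ (toVertex u)) x ≟ toℕ (toVertex v) ⌋  ≡⟨ cong₂ (λ k l → ∑[ x < d ] 𝟙 ⌊ step k x ≟ l ⌋) (toℕ-toVertex u) (toℕ-toVertex v) ⟩
        ∑[ x < d ] 𝟙 ⌊ step (encode u) x ≟ encode v ⌋                  ≡⟨ sumBelow-cong d (λ x x<d → cong (λ k → 𝟙 ⌊ k ≟ encode v ⌋) (step-encode u x<d)) ⟩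
        ∑[ x < d ] 𝟙 ⌊ encode (shift u (letter x)) ≟ encode v ⌋        ≡⟨ B-arcs-count encode encode-injective u v ⟩
        arcs (B d n) u v                                                ∎
        where open ≡-Reasoning

  B≅H⇒gcd≡1 : 1 < d → B d n ≅ H p q d → gcd P N ≡ 1
  B≅H⇒gcd≡1 1<d iso with gcd P N ≟ 1
  ... | yes gcd≡1 = gcd≡1
  ... | no  gcd≢1 = ⊥-elim (CommonDivisor.¬B≅H (gcd[m,n]∣m P N) gcd∣Q gcd≢1 1<d iso)
    where
    gcd∣Q : gcd P N ∣ Q
    gcd∣Q = ∣m+n∣m⇒∣n (subst (gcd P N ∣_) (sym P+Q≡N) (gcd[m,n]∣n P N)) (gcd[m,n]∣m P N)

  gcd≡1⇒B≅H : gcd P N ≡ 1 → B d n ≅ H p q d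
  gcd≡1⇒B≅H gcd≡1 with inverse-mod {P} {n₁} (gcd≡1⇒coprime gcd≡1)
  ... | e , e*P≡1 = ModularInverse.B≅H {e} e*P≡1

theorem2p3 : (d n p′ : ℕ) → .{{_ : NonZero d}} → d ≥ 2 → n ≥ 1 → p′ ≤ n + 1 →
    ((B d n ≅ H (d ^ p′) (d ^ (n + 1 ∸ p′)) d) ⇔ (gcd p′ (n + 1) ≡ 1))
theorem2p3 d zero     p′ _   () _
theorem2p3 d (suc n₁) p′ 1<d _  p′≤n+1 =
  subst (λ N → (B d (suc n₁) ≅ H (d ^ p′) (d ^ (suc n₁ + 1 ∸ p′)) d) ⇔ (gcd p′ N ≡ 1)) (sym n+1≡2+n₁)
        (mk⇔ (B≅H⇒gcd≡1 1<d) gcd≡1⇒B≅H)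
  where
  n+1≡2+n₁ : suc n₁ + 1 ≡ 2 + n₁
  n+1≡2+n₁ = +-comm (suc n₁) 1
  open H-powers d n₁ p′ (suc n₁ + 1 ∸ p′) (trans (m+[n∸m]≡n p′≤n+1) n+1≡2+n₁)
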